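{- Let $p$ be an odd prime, $a$ an integer with $p\nmid a$, $b=b_0p^{b_1}$, $c=c_0p^{c_1}$ with $0\le b_1\le c_1$, $\gcd(b_0,p)=\gcd(c_0,p)=1$, and let $m=m_0p^{m_1}$ be a nonzero integer with $\gcd(m_0,p)=1$. Let $k>m_1$ be an integer and for $0\le\tau\le k-1$ set $$s_{k,\tau}=\sum_{t_0\in(\mathbb Z/p^{k-\tau}\mathbb Z)^*}e\!\left(\frac{ -m_0t_0p^{m_1+\tau}}{p^k}\right)G(at_0p^\tau;p^k)\,G(b_0t_0p^{b_1+\tau};p^k)\,G(c_0t_0p^{c_1+\tau};p^k).$$ If $0\le\tau\le k-m_1-2$, then $s_{k,\tau}=0$.
   Context: $e(w)=e^{2\pi i w}$; $G(a;q)=\sum_{j=0}^{q-1}e\!\left(\frac{aj^2}{q}\right)$. The summand depends only on $t_0$ modulo $p^{k-\tau}$. -}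

module Defs where

open import Algebra.Bundles using (CommutativeRing)
open import Data.Nat as ℕ using (ℕ; zero; suc; NonZero)
open import Data.Nat.Properties using (m^n≢0)
open import Data.Integer as ℤ using (ℤ; +_)
open import Data.Integer.DivMod using (_%ℕ_)
open import Data.Nat.Coprimality using (coprime?)
open import Relation.Nullary.Decidable using (does)
open import Data.Bool using (if_then_else_)

-- We work in an arbitrary commutative ring R containing an element ζ that is a
-- root of the cyclotomic polynomial Φ_{p^k}(x) = Σ_{i<p} x^{i·p^{k-1}}.
-- ζ plays the role of e(1/p^k); e(x/p^k) is ζ^(x mod p^k).
module Cyclo {c ℓ} (R : CommutativeRing c ℓ) where
  open CommutativeRing R

  pow : Carrier → ℕ → Carrier
  pow x zero    = 1#
  pow x (suc n) = x * pow x n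

  Σ< : ℕ → (ℕ → Carrier) → Carrier
  Σ< zero    f = 0#
  Σ< (suc n) f = Σ< n f + f n

  -- Φ_{p^k}(ζ) = 0  (used with k ≥ 1)
  CyclotomicRoot : (p k : ℕ) → Carrier → Set ℓ
  CyclotomicRoot p k ζ = Σ< p (λ i → pow ζ (i ℕ.* p ℕ.^ (k ℕ.∸ 1))) ≈ 0#

  e : (q : ℕ) .{{_ : NonZero q}} → Carrier → ℤ → Carrier
  e q ζ x = pow ζ (x %ℕ q)

  G : (q : ℕ) .{{_ : NonZero q}} → Carrier → ℤ → Carrier
  G q ζ A = Σ< q (λ j → e q ζ (A ℤ.* (+ j) ℤ.* (+ j)))

  s : (p : ℕ) .{{_ : NonZero p}} → (ζ : Carrier) → (k τ : ℕ) →
      (a b₀ : ℤ) (b₁ : ℕ) (c₀ : ℤ) (c₁ : ℕ) (m₀ : ℤ) (m₁ : ℕ) → Carrier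
  s p ζ k τ a b₀ b₁ c₀ c₁ m₀ m₁ =
    Σ< N (λ t₀ → if does (coprime? t₀ N) then term (+ t₀) else 0#)
    where
      N = p ℕ.^ (k ℕ.∸ τ)
      q = p ℕ.^ k
      instance
        nzq : NonZero q
        nzq = m^n≢0 p k
      pp : ℕ → ℤ
      pp n = + (p ℕ.^ n)
      term : ℤ → Carrier
      term t = e q ζ (ℤ.- m₀ ℤ.* t ℤ.* pp (m₁ ℕ.+ τ))
             * G q ζ (a ℤ.* t ℤ.* pp τ)
             * G q ζ (b₀ ℤ.* t ℤ.* pp (b₁ ℕ.+ τ))
             * G q ζ (c₀ ℤ.* t ℤ.* pp (c₁ ℕ.+ τ))

{-# OPTIONS --safe #-}
-- Write k − τ = (d + 1) + (m₁ + 1) and split t₀ = r + p^(d+1) i with r < p^(d+1), i < p^(m₁+1).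
-- As p ∣ p^(d+1), coprimality of t₀ and each Gauss factor depend only on r: for p ∤ A the sum
-- G(A pᵉ; pᵏ) depends only on A mod p, since G(A; p^(n+2)) = p · G(A; pⁿ) reduces every such
-- sum to modulus 1 or p.  Because p^(d+1) · p^(m₁+τ) = p^(k−1), the exponential factor splits off
-- e(−m₀ i / p), and the sum over i of these vanishes: ζ^(p^(k−1)) is a root of 1 + x + ⋯ + x^(p−1)
-- and p ∤ m₀.
module Submission where

open import Defs
open import Algebra.Bundles using (CommutativeRing)
open import Level using (Level)
open import Data.Nat as ℕ using (ℕ; _≤_; _<_; _+_)
open import Data.Nat.Primality using (Prime; prime⇒nonZero)
open import Data.Nat.Coprimality using (Coprime)
open import Data.Integer as ℤ using (ℤ; +_; ∣_∣)
open import Data.Integer.Divisibility using (_∣_)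
open import Relation.Nullary using (¬_)
open import Relation.Binary.PropositionalEquality using (_≢_)

open import Data.Nat using (zero; suc; _*_; _^_; _%_; _/_; _∸_; NonZero)
import Data.Nat.Properties as ℕP
import Data.Nat.DivMod as ℕD
import Data.Nat.Divisibility as ℕ∣
open import Data.Nat.Divisibility using (_∣?_)
open import Data.Nat.Primality using (prime⇒nonTrivial; euclidsLemma; prime⇒irreducible)
open import Data.Nat.Coprimality using (coprime?; coprime-Bézout; coprime-divisor; prime⇒coprime)
open import Data.Nat.GCD using (module Bézout)
import Data.Nat.Tactic.RingSolver as ℕSolver
open import Data.Integer using (-[1+_]) renaming (_+_ to _+ᶻ_; _*_ to _*ᶻ_; -_ to -ᶻ_; _-_ to _-ᶻ_)
import Data.Integer.Properties as ℤP
open import Data.Integer.DivMod using (_%ℕ_; _/ℕ_; a≡a%ℕn+[a/ℕn]*n; n%ℕd<d)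
import Data.Integer.Divisibility.Signed as ℤ∣
open import Data.Integer.Tactic.RingSolver using (solve)
open import Data.List using (_∷_; [])
open import Data.Bool using (if_then_else_)
open import Data.Empty using (⊥-elim)
open import Data.Product using (∃; _,_)
open import Data.Sum using (inj₁; inj₂)
open import Data.Fin as F using (Fin)
import Data.Fin.Properties as FP
open import Data.Fin.Permutation as Perm using (Permutation; _⟨$⟩ʳ_)
open import Relation.Nullary using (yes; no; does)
open import Relation.Nullary.Decidable using (dec-true; dec-false)
open import Relation.Binary.PropositionalEquality as P using (_≡_)
import Relation.Binary.Reasoning.Setoid
import Algebra.Properties.CommutativeSemigroup as CommSemigroupProperties

pos-+-* : ∀ m n o → + (m + n * o) ≡ + m +ᶻ + n *ᶻ + o
pos-+-* m n o = P.trans (ℤP.pos-+ m (n * o)) (P.cong (+ m +ᶻ_) (ℤP.pos-* n o))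

+*-flip : ∀ {x} y z Q → x ≡ y +ᶻ z *ᶻ Q → y ≡ x +ᶻ (-ᶻ z) *ᶻ Q
+*-flip y z Q P.refl = solve (y ∷ z ∷ Q ∷ [])

+*-shift : ∀ {x} y z w Q → x ≡ y +ᶻ z *ᶻ Q → x +ᶻ w *ᶻ Q ≡ y +ᶻ (z +ᶻ w) *ᶻ Q
+*-shift y z w Q P.refl = solve (y ∷ z ∷ w ∷ Q ∷ [])

+*-add : ∀ {x y} r z s w Q → x ≡ r +ᶻ z *ᶻ Q → y ≡ s +ᶻ w *ᶻ Q → x +ᶻ y ≡ (r +ᶻ s) +ᶻ (z +ᶻ w) *ᶻ Q
+*-add r z s w Q P.refl P.refl = solve (r ∷ z ∷ s ∷ w ∷ Q ∷ [])

pos-*-* : ∀ m n o → + (m * n * o) ≡ + m *ᶻ + n *ᶻ + o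
pos-*-* m n o = P.trans (ℤP.pos-* (m * n) o) (P.cong (_*ᶻ + o) (ℤP.pos-* m n))

square-expand : ∀ {B} y C N j l Q M → C *ᶻ N ≡ B → B *ᶻ N ≡ Q *ᶻ M →
                y *ᶻ C *ᶻ (j +ᶻ N *ᶻ l) *ᶻ (j +ᶻ N *ᶻ l)
                ≡ (y *ᶻ C *ᶻ j *ᶻ j +ᶻ + 2 *ᶻ y *ᶻ j *ᶻ l *ᶻ B) +ᶻ (y *ᶻ l *ᶻ l *ᶻ M) *ᶻ Q
square-expand y C N j l Q M P.refl CN*N≡Q*M = begin
  y *ᶻ C *ᶻ (j +ᶻ N *ᶻ l) *ᶻ (j +ᶻ N *ᶻ l)
    ≡⟨ solve (y ∷ C ∷ N ∷ j ∷ l ∷ []) ⟩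
  (y *ᶻ C *ᶻ j *ᶻ j +ᶻ + 2 *ᶻ y *ᶻ j *ᶻ l *ᶻ (C *ᶻ N)) +ᶻ y *ᶻ l *ᶻ l *ᶻ (C *ᶻ N *ᶻ N)
    ≡⟨ P.cong (λ t → (y *ᶻ C *ᶻ j *ᶻ j +ᶻ + 2 *ᶻ y *ᶻ j *ᶻ l *ᶻ (C *ᶻ N)) +ᶻ y *ᶻ l *ᶻ l *ᶻ t) CN*N≡Q*M ⟩
  (y *ᶻ C *ᶻ j *ᶻ j +ᶻ + 2 *ᶻ y *ᶻ j *ᶻ l *ᶻ (C *ᶻ N)) +ᶻ y *ᶻ l *ᶻ l *ᶻ (Q *ᶻ M)
    ≡⟨ solve (y ∷ C ∷ N ∷ j ∷ l ∷ Q ∷ M ∷ []) ⟩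
  (y *ᶻ C *ᶻ j *ᶻ j +ᶻ + 2 *ᶻ y *ᶻ j *ᶻ l *ᶻ (C *ᶻ N)) +ᶻ (y *ᶻ l *ᶻ l *ᶻ M) *ᶻ Q
    ∎
  where open P.≡-Reasoning

scaled-square-shift : ∀ {y} y′ z P Pᵉ j W Q → y ≡ y′ +ᶻ z *ᶻ P → Pᵉ *ᶻ P ≡ W *ᶻ Q →
                      y *ᶻ Pᵉ *ᶻ j *ᶻ j ≡ y′ *ᶻ Pᵉ *ᶻ j *ᶻ j +ᶻ (z *ᶻ j *ᶻ j *ᶻ W) *ᶻ Q
scaled-square-shift y′ z P Pᵉ j W Q P.refl Pᵉ*P≡W*Q = begin
  (y′ +ᶻ z *ᶻ P) *ᶻ Pᵉ *ᶻ j *ᶻ j                  ≡⟨ solve (y′ ∷ z ∷ P ∷ Pᵉ ∷ j ∷ []) ⟩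
  y′ *ᶻ Pᵉ *ᶻ j *ᶻ j +ᶻ z *ᶻ j *ᶻ j *ᶻ (Pᵉ *ᶻ P)  ≡⟨ P.cong (λ t → y′ *ᶻ Pᵉ *ᶻ j *ᶻ j +ᶻ z *ᶻ j *ᶻ j *ᶻ t) Pᵉ*P≡W*Q ⟩
  y′ *ᶻ Pᵉ *ᶻ j *ᶻ j +ᶻ z *ᶻ j *ᶻ j *ᶻ (W *ᶻ Q)   ≡⟨ solve (y′ ∷ z ∷ Pᵉ ∷ j ∷ W ∷ Q ∷ []) ⟩
  y′ *ᶻ Pᵉ *ᶻ j *ᶻ j +ᶻ (z *ᶻ j *ᶻ j *ᶻ W) *ᶻ Q  ∎
  where open P.≡-Reasoning

module FiniteSums {c ℓ} (R : CommutativeRing c ℓ) where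
  open CommutativeRing R renaming (_+_ to _⊕_; _*_ to _⊗_)
  open Cyclo R using (Σ<)
  open import Relation.Binary.Reasoning.Setoid setoid
  open import Algebra.Properties.CommutativeMonoid.Sum +-commutativeMonoid using (sum; sum-permute; sum-cong-≗)
  open CommSemigroupProperties +-commutativeSemigroup using (x∙yz≈y∙xz)

  Σ<-cong< : ∀ n {f g : ℕ → Carrier} → (∀ i → i < n → f i ≈ g i) → Σ< n f ≈ Σ< n g
  Σ<-cong< zero    f≈g = refl
  Σ<-cong< (suc n) f≈g = +-cong (Σ<-cong< n (λ i i<n → f≈g i (ℕP.m<n⇒m<1+n i<n))) (f≈g n ℕP.≤-refl)

  Σ<-cong : ∀ n {f g : ℕ → Carrier} → (∀ i → f i ≈ g i) → Σ< n f ≈ Σ< n g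
  Σ<-cong n f≈g = Σ<-cong< n (λ i _ → f≈g i)

  Σ<-congˡ : ∀ {m n} (f : ℕ → Carrier) → m ≡ n → Σ< m f ≈ Σ< n f
  Σ<-congˡ f P.refl = refl

  Σ<-zero : ∀ n {f : ℕ → Carrier} → (∀ i → i < n → f i ≈ 0#) → Σ< n f ≈ 0#
  Σ<-zero zero    f≈0 = refl
  Σ<-zero (suc n) f≈0 =
    trans (+-cong (Σ<-zero n (λ i i<n → f≈0 i (ℕP.m<n⇒m<1+n i<n))) (f≈0 n ℕP.≤-refl)) (+-identityʳ 0#)

  Σ<-distrib-⊕ : ∀ n (f g : ℕ → Carrier) → Σ< n (λ i → f i ⊕ g i) ≈ Σ< n f ⊕ Σ< n g
  Σ<-distrib-⊕ zero    f g = sym (+-identityʳ 0#)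
  Σ<-distrib-⊕ (suc n) f g = begin
    Σ< n (λ i → f i ⊕ g i) ⊕ (f n ⊕ g n) ≈⟨ +-congʳ (Σ<-distrib-⊕ n f g) ⟩
    (Σ< n f ⊕ Σ< n g) ⊕ (f n ⊕ g n)      ≈⟨ +-assoc _ _ _ ⟩
    Σ< n f ⊕ (Σ< n g ⊕ (f n ⊕ g n))      ≈⟨ +-congˡ (x∙yz≈y∙xz (Σ< n g) (f n) (g n)) ⟩
    Σ< n f ⊕ (f n ⊕ (Σ< n g ⊕ g n))      ≈⟨ +-assoc _ _ _ ⟨
    (Σ< n f ⊕ f n) ⊕ (Σ< n g ⊕ g n)      ∎

  Σ<-distribʳ-⊗ : ∀ n (f : ℕ → Carrier) x → Σ< n (λ i → f i ⊗ x) ≈ Σ< n f ⊗ x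
  Σ<-distribʳ-⊗ zero    f x = sym (zeroˡ x)
  Σ<-distribʳ-⊗ (suc n) f x = trans (+-congʳ (Σ<-distribʳ-⊗ n f x)) (sym (distribʳ x _ _))

  Σ<-distribˡ-⊗ : ∀ n (f : ℕ → Carrier) x → Σ< n (λ i → x ⊗ f i) ≈ x ⊗ Σ< n f
  Σ<-distribˡ-⊗ n f x =
    trans (Σ<-cong n (λ i → *-comm x (f i))) (trans (Σ<-distribʳ-⊗ n f x) (*-comm _ x))

  Σ<-+ : ∀ m n (f : ℕ → Carrier) → Σ< (m + n) f ≈ Σ< m f ⊕ Σ< n (λ i → f (m + i))
  Σ<-+ m zero    f = trans (Σ<-congˡ f (ℕP.+-identityʳ m)) (sym (+-identityʳ _))
  Σ<-+ m (suc n) f = begin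
    Σ< (m + suc n) f                               ≈⟨ Σ<-congˡ f (ℕP.+-suc m n) ⟩
    Σ< (m + n) f ⊕ f (m + n)                       ≈⟨ +-congʳ (Σ<-+ m n f) ⟩
    (Σ< m f ⊕ Σ< n (λ i → f (m + i))) ⊕ f (m + n) ≈⟨ +-assoc _ _ _ ⟩
    Σ< m f ⊕ Σ< (suc n) (λ i → f (m + i))          ∎

  Σ<-* : ∀ m n (f : ℕ → Carrier) → Σ< (m * n) f ≈ Σ< n (λ i → Σ< m (λ r → f (r + m * i)))
  Σ<-* m zero    f = Σ<-congˡ f (ℕP.*-zeroʳ m)
  Σ<-* m (suc n) f = begin
    Σ< (m * suc n) f                                 ≈⟨ Σ<-congˡ f (P.trans (ℕP.*-suc m n) (ℕP.+-comm m (m * n))) ⟩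
    Σ< (m * n + m) f                                 ≈⟨ Σ<-+ (m * n) m f ⟩
    Σ< (m * n) f ⊕ Σ< m (λ r → f (m * n + r))        ≈⟨ +-cong (Σ<-* m n f)
                                                           (Σ<-cong m (λ r → reflexive (P.cong f (ℕP.+-comm (m * n) r)))) ⟩
    Σ< (suc n) (λ i → Σ< m (λ r → f (r + m * i)))    ∎

  Σ<-swap : ∀ m n (f : ℕ → ℕ → Carrier) →
            Σ< m (λ i → Σ< n (f i)) ≈ Σ< n (λ j → Σ< m (λ i → f i j))
  Σ<-swap zero    n f = sym (Σ<-zero n (λ _ _ → refl))
  Σ<-swap (suc m) n f = trans (+-congʳ (Σ<-swap m n f)) (sym (Σ<-distrib-⊕ n _ (f m)))

  Σ<-suc : ∀ n (f : ℕ → Carrier) → Σ< (suc n) f ≈ f 0 ⊕ Σ< n (λ i → f (suc i))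
  Σ<-suc zero    f = trans (+-identityˡ _) (sym (+-identityʳ _))
  Σ<-suc (suc n) f = trans (+-congʳ (Σ<-suc n f)) (+-assoc _ _ _)

  Σ<-head : ∀ n (f : ℕ → Carrier) → 0 < n → (∀ i → 0 < i → i < n → f i ≈ 0#) → Σ< n f ≈ f 0
  Σ<-head (suc n) f _ tail≈0 = begin
    Σ< (suc n) f                   ≈⟨ Σ<-suc n f ⟩
    f 0 ⊕ Σ< n (λ i → f (suc i))   ≈⟨ +-congˡ (Σ<-zero n (λ i i<n → tail≈0 (suc i) (ℕ.s≤s ℕ.z≤n) (ℕ.s≤s i<n))) ⟩
    f 0 ⊕ 0#                       ≈⟨ +-identityʳ _ ⟩
    f 0                            ∎

  Σ<≈sum : ∀ n (f : ℕ → Carrier) → Σ< n f ≈ sum {n} (λ i → f (F.toℕ i))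
  Σ<≈sum zero    f = refl
  Σ<≈sum (suc n) f = trans (Σ<-suc n f) (+-congˡ (Σ<≈sum n (λ i → f (suc i))))

  Σ<-permute : ∀ n (f : ℕ → Carrier) (σ σ⁻¹ : ℕ → ℕ) →
               (∀ i → i < n → σ i < n) → (∀ i → i < n → σ⁻¹ i < n) →
               (∀ i → i < n → σ (σ⁻¹ i) ≡ i) → (∀ i → i < n → σ⁻¹ (σ i) ≡ i) →
               Σ< n f ≈ Σ< n (λ i → f (σ i))
  Σ<-permute n f σ σ⁻¹ σ< σ⁻¹< σσ⁻¹ σ⁻¹σ = begin
    Σ< n f                                    ≈⟨ Σ<≈sum n f ⟩
    sum {n} (λ i → f (F.toℕ i))               ≈⟨ sum-permute (λ i → f (F.toℕ i)) π ⟩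
    sum {n} (λ i → f (F.toℕ (π ⟨$⟩ʳ i)))      ≡⟨ sum-cong-≗ {n} (λ i → P.cong f (FP.toℕ-fromℕ< (σ< (F.toℕ i) (FP.toℕ<n i)))) ⟩
    sum {n} (λ i → f (σ (F.toℕ i)))           ≈⟨ Σ<≈sum n (λ i → f (σ i)) ⟨
    Σ< n (λ i → f (σ i))                      ∎
    where
    lift : (ρ : ℕ → ℕ) → (∀ i → i < n → ρ i < n) → Fin n → Fin n
    lift ρ ρ< i = F.fromℕ< (ρ< (F.toℕ i) (FP.toℕ<n i))
    inverse : ∀ ρ ρ′ ρ< ρ′< → (∀ i → i < n → ρ (ρ′ i) ≡ i) → ∀ i → lift ρ ρ< (lift ρ′ ρ′< i) ≡ i
    inverse ρ ρ′ ρ< ρ′< ρρ′ i = FP.toℕ-injective (P.trans (FP.toℕ-fromℕ< _)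
      (P.trans (P.cong ρ (FP.toℕ-fromℕ< _)) (ρρ′ (F.toℕ i) (FP.toℕ<n i))))
    π : Permutation n n
    π = Perm.permutation (lift σ σ<) (lift σ⁻¹ σ⁻¹<)
          (inverse σ σ⁻¹ σ< σ⁻¹< σσ⁻¹) (inverse σ⁻¹ σ σ⁻¹< σ< σ⁻¹σ)

module Powers {c ℓ} (R : CommutativeRing c ℓ) where
  open CommutativeRing R renaming (_+_ to _⊕_; _*_ to _⊗_)
  open Cyclo R using (pow)
  import Algebra.Properties.Semiring.Exp semiring as Exp
  open import Relation.Binary.Reasoning.Setoid setoid

  pow≡^ : ∀ x n → pow x n ≡ x Exp.^ n
  pow≡^ x zero    = P.refl
  pow≡^ x (suc n) = P.cong (x ⊗_) (pow≡^ x n)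

  pow-congˡ : ∀ {x y} n → x ≈ y → pow x n ≈ pow y n
  pow-congˡ {x} {y} n x≈y rewrite pow≡^ x n | pow≡^ y n = Exp.^-congˡ n x≈y

  pow-homo-+ : ∀ x m n → pow x (m + n) ≈ pow x m ⊗ pow x n
  pow-homo-+ x m n rewrite pow≡^ x (m + n) | pow≡^ x m | pow≡^ x n = Exp.^-homo-* x m n

  pow-assocʳ : ∀ x m n → pow (pow x m) n ≈ pow x (m * n)
  pow-assocʳ x m n rewrite pow≡^ (pow x m) n | pow≡^ x m | pow≡^ x (m * n) = Exp.^-assocʳ x m n

  pow-1# : ∀ n → pow 1# n ≈ 1#
  pow-1# zero    = refl
  pow-1# (suc n) = trans (*-identityˡ _) (pow-1# n)

  pow-periodic : ∀ {x q} → pow x q ≈ 1# → ∀ b n → pow x (b + n * q) ≈ pow x b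
  pow-periodic {x} {q} x^q≈1 b n = begin
    pow x (b + n * q)         ≈⟨ pow-homo-+ x b (n * q) ⟩
    pow x b ⊗ pow x (n * q)   ≡⟨ P.cong (λ m → pow x b ⊗ pow x m) (ℕP.*-comm n q) ⟩
    pow x b ⊗ pow x (q * n)   ≈⟨ *-congˡ (pow-assocʳ x q n) ⟨
    pow x b ⊗ pow (pow x q) n ≈⟨ *-congˡ (trans (pow-congˡ n x^q≈1) (pow-1# n)) ⟩
    pow x b ⊗ 1#              ≈⟨ *-identityʳ _ ⟩
    pow x b                   ∎

  pow-% : ∀ {x} q .{{_ : NonZero q}} → pow x q ≈ 1# → ∀ n → pow x n ≈ pow x (n % q)
  pow-% {x} q x^q≈1 n =
    trans (reflexive (P.cong (pow x) (ℕD.m≡m%n+[m/n]*n n q))) (pow-periodic x^q≈1 (n % q) (n / q))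

module Exponentials {c ℓ} (R : CommutativeRing c ℓ) (q : ℕ) .{{_ : NonZero q}}
                    (ζ : CommutativeRing.Carrier R)
                    (ζ^q≈1 : CommutativeRing._≈_ R (Cyclo.pow R ζ q) (CommutativeRing.1# R)) where
  open CommutativeRing R renaming (_+_ to _⊕_; _*_ to _⊗_)
  open Cyclo R using (pow; e)
  open Powers R

  E : ℤ → Carrier
  E = e q ζ

  pow-cong-mod : ∀ a b z → + a ≡ + b +ᶻ z *ᶻ + q → pow ζ a ≈ pow ζ b
  pow-cong-mod a b (+ n) a≡b+nq = trans (reflexive (P.cong (pow ζ) a≡b+n*q)) (pow-periodic ζ^q≈1 b n)
    where
    a≡b+n*q : a ≡ b + n * q
    a≡b+n*q = ℤP.+-injective (P.trans a≡b+nq (P.sym (pos-+-* b n q)))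
  pow-cong-mod a b z@(-[1+ n ]) a≡b+zq =
    sym (trans (reflexive (P.cong (pow ζ) b≡a+[1+n]*q)) (pow-periodic ζ^q≈1 a (suc n)))
    where
    b≡a+[1+n]*q : b ≡ a + suc n * q
    b≡a+[1+n]*q = ℤP.+-injective (P.trans (+*-flip (+ b) z (+ q) a≡b+zq) (P.sym (pos-+-* a (suc n) q)))

  E≈pow : ∀ x b z → x ≡ + b +ᶻ z *ᶻ + q → E x ≈ pow ζ b
  E≈pow x b z x≡b+zq = pow-cong-mod (x %ℕ q) b (z -ᶻ x /ℕ q)
    (P.trans (+*-flip (+ (x %ℕ q)) (x /ℕ q) (+ q) (a≡a%ℕn+[a/ℕn]*n x q))
             (+*-shift (+ b) z (-ᶻ (x /ℕ q)) (+ q) x≡b+zq))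

  E-cong-mod : ∀ {x} y z → x ≡ y +ᶻ z *ᶻ + q → E x ≈ E y
  E-cong-mod {x} y z x≡y+zq = E≈pow x (y %ℕ q) (y /ℕ q +ᶻ z)
    (P.trans x≡y+zq (+*-shift (+ (y %ℕ q)) (y /ℕ q) z (+ q) (a≡a%ℕn+[a/ℕn]*n y q)))

  E-homo-+ : ∀ x y → E (x +ᶻ y) ≈ E x ⊗ E y
  E-homo-+ x y = trans
    (E≈pow (x +ᶻ y) (x %ℕ q + y %ℕ q) (x /ℕ q +ᶻ y /ℕ q)
      (P.trans (+*-add (+ (x %ℕ q)) (x /ℕ q) (+ (y %ℕ q)) (y /ℕ q) (+ q)
                  (a≡a%ℕn+[a/ℕn]*n x q) (a≡a%ℕn+[a/ℕn]*n y q))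
               (P.cong (λ r → r +ᶻ (x /ℕ q +ᶻ y /ℕ q) *ᶻ + q) (P.sym (ℤP.pos-+ (x %ℕ q) (y %ℕ q))))))
    (pow-homo-+ ζ (x %ℕ q) (y %ℕ q))

  E-multiple : ∀ z → E (z *ᶻ + q) ≈ 1#
  E-multiple z = E≈pow (z *ᶻ + q) 0 z (P.sym (ℤP.+-identityˡ _))

module PrimeModulus (p : ℕ) (p-prime : Prime p) where
  instance
    p≢0 : NonZero p
    p≢0 = prime⇒nonZero p-prime

  1<p : 1 < p
  1<p = ℕ.nonTrivial⇒n>1 p {{prime⇒nonTrivial p-prime}}

  mod-inverse : ∀ x → 0 < x → x < p → ∃ λ y → (x * y) % p ≡ 1
  mod-inverse x@(suc _) _ x<p with coprime-Bézout (prime⇒coprime p-prime x<p)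
  ... | Bézout.-+ a y 1+ap≡yx = y , (begin
    (x * y) % p      ≡⟨ P.cong (_% p) (P.trans (ℕP.*-comm x y) (P.sym 1+ap≡yx)) ⟩
    (1 + a * p) % p  ≡⟨ ℕD.[m+kn]%n≡m%n 1 a p ⟩
    1 % p            ≡⟨ ℕD.m<n⇒m%n≡m 1<p ⟩
    1                ∎)
    where open P.≡-Reasoning
  -- Here x · y ≡ −1 (mod p), so y · (p − 1) is an inverse.
  ... | Bézout.+- a y 1+yx≡ap = y * p′ , (begin
    (x * (y * p′)) % p            ≡⟨ ℕD.[m+n]%n≡m%n (x * (y * p′)) p ⟨
    (x * (y * p′) + p) % p        ≡⟨ P.cong (λ n → (x * (y * p′) + n) % p) (P.sym p′+1≡p) ⟩
    (x * (y * p′) + suc p′) % p   ≡⟨ P.cong (_% p) (regroup x y p′) ⟩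
    (1 + (1 + y * x) * p′) % p    ≡⟨ P.cong (λ n → (1 + n * p′) % p) 1+yx≡ap ⟩
    (1 + a * p * p′) % p          ≡⟨ P.cong (λ n → (1 + n) % p) (ℕP.*-comm (a * p) p′) ⟩
    (1 + p′ * (a * p)) % p        ≡⟨ P.cong (λ n → (1 + n) % p) (ℕP.*-assoc p′ a p) ⟨
    (1 + p′ * a * p) % p          ≡⟨ ℕD.[m+kn]%n≡m%n 1 (p′ * a) p ⟩
    1 % p                         ≡⟨ ℕD.m<n⇒m%n≡m 1<p ⟩
    1                             ∎)
    where
    open P.≡-Reasoning
    p′ : ℕ
    p′ = p ∸ 1
    p′+1≡p : suc p′ ≡ p
    p′+1≡p = ℕP.suc-pred p
    regroup : ∀ x y p′ → x * (y * p′) + suc p′ ≡ 1 + (1 + y * x) * p′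
    regroup = ℕSolver.solve-∀

  mod-inverse-cancel : ∀ x y → (x * y) % p ≡ 1 → ∀ u → u < p → (x * ((y * u) % p)) % p ≡ u
  mod-inverse-cancel x y xy≡1 u u<p = begin
    (x * ((y * u) % p)) % p            ≡⟨ ℕD.%-distribˡ-* x ((y * u) % p) p ⟩
    ((x % p) * ((y * u) % p % p)) % p  ≡⟨ P.cong (λ n → ((x % p) * n) % p) (ℕD.m%n%n≡m%n (y * u) p) ⟩
    ((x % p) * ((y * u) % p)) % p      ≡⟨ ℕD.%-distribˡ-* x (y * u) p ⟨
    (x * (y * u)) % p                  ≡⟨ P.cong (_% p) (ℕP.*-assoc x y u) ⟨
    (x * y * u) % p                    ≡⟨ ℕD.%-distribˡ-* (x * y) u p ⟩
    ((x * y) % p * (u % p)) % p        ≡⟨ P.cong (λ n → (n * (u % p)) % p) xy≡1 ⟩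
    (1 * (u % p)) % p                  ≡⟨ P.cong (_% p) (ℕP.*-identityˡ (u % p)) ⟩
    u % p % p                          ≡⟨ ℕD.m%n%n≡m%n u p ⟩
    u % p                              ≡⟨ ℕD.m<n⇒m%n≡m u<p ⟩
    u                                  ∎
    where open P.≡-Reasoning

  Unit : ℤ → Set
  Unit x = ¬ (+ p ∣ x)

  unit-* : ∀ x y → Unit x → Unit y → Unit (x *ᶻ y)
  unit-* x y x-unit y-unit p∣xy
    with euclidsLemma ∣ x ∣ ∣ y ∣ p-prime (P.subst (p ℕ∣.∣_) (ℤP.abs-* x y) p∣xy)
  ... | inj₁ p∣x = x-unit p∣x
  ... | inj₂ p∣y = y-unit p∣y

  unit-neg : ∀ x → Unit x → Unit (-ᶻ x)
  unit-neg x x-unit p∣-x = x-unit (P.subst (p ℕ∣.∣_) (ℤP.∣-i∣≡∣i∣ x) p∣-x)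

  unit⇒%≢0 : ∀ x → Unit x → x %ℕ p ≢ 0
  unit⇒%≢0 x x-unit x%p≡0 = x-unit (ℤ∣.∣⇒∣ᵤ (ℤ∣.divides (x /ℕ p) (begin
    x                                ≡⟨ a≡a%ℕn+[a/ℕn]*n x p ⟩
    + (x %ℕ p) +ᶻ (x /ℕ p) *ᶻ + p    ≡⟨ P.cong (λ n → + n +ᶻ (x /ℕ p) *ᶻ + p) x%p≡0 ⟩
    + 0 +ᶻ (x /ℕ p) *ᶻ + p           ≡⟨ ℤP.+-identityˡ _ ⟩
    (x /ℕ p) *ᶻ + p                  ∎)))
    where open P.≡-Reasoning

  unit-2 : p ≢ 2 → Unit (+ 2)
  unit-2 p≢2 p∣2 = p≢2 (ℕP.≤-antisym (ℕ∣.∣⇒≤ p∣2) 1<p)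

  coprime⇒unit : ∀ x → Coprime ∣ x ∣ p → Unit x
  coprime⇒unit x coprime p∣x = ℕP.<⇒≢ 1<p (P.sym (coprime (p∣x , ℕ∣.∣-refl)))

  coprime-^ : ∀ {x} → ¬ (p ℕ∣.∣ x) → ∀ n → Coprime x (p ^ n)
  coprime-^ p∤x zero    (_ , d∣1)         = ℕ∣.∣1⇒≡1 d∣1
  coprime-^ p∤x (suc n) {d} (d∣x , d∣pⁿ⁺¹) = coprime-^ p∤x n (d∣x , coprime-divisor d-coprime-p d∣pⁿ⁺¹)
    where
    d-coprime-p : Coprime d p
    d-coprime-p (e∣d , e∣p) with prime⇒irreducible p-prime e∣p
    ... | inj₁ e≡1    = e≡1
    ... | inj₂ P.refl = ⊥-elim (p∤x (ℕ∣.∣-trans e∣d d∣x))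

module CyclotomicSums {c ℓ} (R : CommutativeRing c ℓ) (p : ℕ) (p-prime : Prime p)
                      (ω : CommutativeRing.Carrier R)
                      (Φₚ[ω]≈0 : CommutativeRing._≈_ R (Cyclo.Σ< R p (Cyclo.pow R ω)) (CommutativeRing.0# R)) where
  open CommutativeRing R renaming (_+_ to _⊕_; _*_ to _⊗_)
  open Cyclo R using (pow; Σ<)
  open FiniteSums R
  open Powers R
  open PrimeModulus p p-prime
  open import Relation.Binary.Reasoning.Setoid setoid

  geometric-sum : ∀ n → Σ< n (pow ω) ⊗ ω ⊕ 1# ≈ Σ< n (pow ω) ⊕ pow ω n
  geometric-sum zero    = +-congʳ (zeroˡ ω)
  geometric-sum (suc n) = begin
    (Σ< n (pow ω) ⊕ pow ω n) ⊗ ω ⊕ 1#           ≈⟨ +-congʳ (distribʳ ω _ _) ⟩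
    (Σ< n (pow ω) ⊗ ω ⊕ pow ω n ⊗ ω) ⊕ 1#        ≈⟨ +-assoc _ _ _ ⟩
    Σ< n (pow ω) ⊗ ω ⊕ (pow ω n ⊗ ω ⊕ 1#)        ≈⟨ +-congˡ (+-comm _ _) ⟩
    Σ< n (pow ω) ⊗ ω ⊕ (1# ⊕ pow ω n ⊗ ω)        ≈⟨ +-assoc _ _ _ ⟨
    (Σ< n (pow ω) ⊗ ω ⊕ 1#) ⊕ pow ω n ⊗ ω        ≈⟨ +-cong (geometric-sum n) (*-comm _ _) ⟩
    (Σ< n (pow ω) ⊕ pow ω n) ⊕ pow ω (suc n)     ∎

  ω^p≈1 : pow ω p ≈ 1#
  ω^p≈1 = begin
    pow ω p                      ≈⟨ +-identityˡ _ ⟨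
    0# ⊕ pow ω p                 ≈⟨ +-congʳ Φₚ[ω]≈0 ⟨
    Σ< p (pow ω) ⊕ pow ω p       ≈⟨ geometric-sum p ⟨
    Σ< p (pow ω) ⊗ ω ⊕ 1#        ≈⟨ +-congʳ (trans (*-congʳ Φₚ[ω]≈0) (zeroˡ ω)) ⟩
    0# ⊕ 1#                      ≈⟨ +-identityˡ 1# ⟩
    1#                           ∎

  Σ<-pow-multiple≈0 : ∀ x → 0 < x → x < p → Σ< p (λ u → pow ω (x * u)) ≈ 0#
  Σ<-pow-multiple≈0 x 0<x x<p with mod-inverse x 0<x x<p
  ... | y , xy≡1 = begin
    Σ< p (λ u → pow ω (x * u))         ≈⟨ Σ<-cong p (λ u → pow-% p ω^p≈1 (x * u)) ⟩
    Σ< p (λ u → pow ω ((x * u) % p))   ≈⟨ Σ<-permute p (pow ω) (λ u → (x * u) % p) (λ u → (y * u) % p)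
                                            (λ u _ → ℕD.m%n<n (x * u) p) (λ u _ → ℕD.m%n<n (y * u) p)
                                            (mod-inverse-cancel x y xy≡1)
                                            (mod-inverse-cancel y x (P.trans (P.cong (_% p) (ℕP.*-comm y x)) xy≡1)) ⟨
    Σ< p (pow ω)                       ≈⟨ Φₚ[ω]≈0 ⟩
    0#                                 ∎

-- ζ plays the role of e(1/p^(k+1)) and ω = ζ^(pᵏ) that of e(1/p); so E x = e(x/p^(k+1)) and
-- linearSum X = Σ_{l<p} e(X l / p).
module PrimePowerRoot {c ℓ} (R : CommutativeRing c ℓ) (p : ℕ) (p-prime : Prime p) (k : ℕ)
                      (ζ : CommutativeRing.Carrier R) (ζ-root : Cyclo.CyclotomicRoot R p (suc k) ζ) where
  open CommutativeRing R renaming (_+_ to _⊕_; _*_ to _⊗_)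
  open Cyclo R using (pow; Σ<; G)
  open FiniteSums R
  open Powers R
  open PrimeModulus p p-prime
  private module ≈ = Relation.Binary.Reasoning.Setoid setoid

  q′ : ℕ
  q′ = p ^ k

  q : ℕ
  q = p ^ suc k

  instance
    q≢0 : NonZero q
    q≢0 = ℕP.m^n≢0 p (suc k)

  ω : Carrier
  ω = pow ζ q′

  Φₚ[ω]≈0 : Σ< p (pow ω) ≈ 0#
  Φₚ[ω]≈0 = trans (Σ<-cong p (λ i → trans (pow-assocʳ ζ q′ i) (reflexive (P.cong (pow ζ) (ℕP.*-comm q′ i))))) ζ-root

  open CyclotomicSums R p p-prime ω Φₚ[ω]≈0

  ζ^q≈1 : pow ζ q ≈ 1#
  ζ^q≈1 = trans (reflexive (P.cong (pow ζ) (ℕP.*-comm p q′))) (trans (sym (pow-assocʳ ζ q′ p)) ω^p≈1)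

  open Exponentials R q ζ ζ^q≈1 public

  linearSum : ℤ → Carrier
  linearSum X = Σ< p (λ l → E (X *ᶻ + l *ᶻ + q′))

  linearSum-unit≈0 : ∀ X → Unit X → linearSum X ≈ 0#
  linearSum-unit≈0 X X-unit =
    trans (Σ<-cong p term) (Σ<-pow-multiple≈0 r (ℕP.n≢0⇒n>0 (unit⇒%≢0 X X-unit)) (n%ℕd<d X p))
    where
    r : ℕ
    r = X %ℕ p
    expand : ∀ {X} r w u P Q′ → X ≡ r +ᶻ w *ᶻ P → X *ᶻ u *ᶻ Q′ ≡ r *ᶻ u *ᶻ Q′ +ᶻ (w *ᶻ u) *ᶻ (P *ᶻ Q′)
    expand r w u P Q′ P.refl = solve (r ∷ w ∷ u ∷ P ∷ Q′ ∷ [])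
    reduce : ∀ u → X *ᶻ + u *ᶻ + q′ ≡ + (r * u * q′) +ᶻ (X /ℕ p *ᶻ + u) *ᶻ + q
    reduce u = begin
      X *ᶻ + u *ᶻ + q′
        ≡⟨ expand (+ r) (X /ℕ p) (+ u) (+ p) (+ q′) (a≡a%ℕn+[a/ℕn]*n X p) ⟩
      + r *ᶻ + u *ᶻ + q′ +ᶻ (X /ℕ p *ᶻ + u) *ᶻ (+ p *ᶻ + q′)
        ≡⟨ P.cong₂ (λ m n → m +ᶻ (X /ℕ p *ᶻ + u) *ᶻ n) (pos-*-* r u q′) (ℤP.pos-* p q′) ⟨
      + (r * u * q′) +ᶻ (X /ℕ p *ᶻ + u) *ᶻ + q
        ∎
      where open P.≡-Reasoning
    term : ∀ u → E (X *ᶻ + u *ᶻ + q′) ≈ pow ω (r * u)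
    term u = begin
      E (X *ᶻ + u *ᶻ + q′) ≈⟨ E≈pow _ (r * u * q′) (X /ℕ p *ᶻ + u) (reduce u) ⟩
      pow ζ (r * u * q′)   ≡⟨ P.cong (pow ζ) (ℕP.*-comm (r * u) q′) ⟩
      pow ζ (q′ * (r * u)) ≈⟨ pow-assocʳ ζ q′ (r * u) ⟨
      pow ω (r * u)        ∎
      where open ≈

  p·1 : Carrier
  p·1 = Σ< p (λ _ → 1#)

  linearSum-multiple : ∀ X → linearSum (X *ᶻ + p) ≈ p·1
  linearSum-multiple X = Σ<-cong p (λ l → trans (reflexive (P.cong E (regroup l))) (E-multiple (X *ᶻ + l)))
    where
    regroup : ∀ l → X *ᶻ + p *ᶻ + l *ᶻ + q′ ≡ (X *ᶻ + l) *ᶻ + q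
    regroup l = P.trans (lemma X (+ p) (+ l) (+ q′)) (P.cong ((X *ᶻ + l) *ᶻ_) (P.sym (ℤP.pos-* p q′)))
      where
      lemma : ∀ X P l Q′ → X *ᶻ P *ᶻ l *ᶻ Q′ ≡ (X *ᶻ l) *ᶻ (P *ᶻ Q′)
      lemma X P l Q′ = solve (X ∷ P ∷ l ∷ Q′ ∷ [])

  longLinearSum-unit≈0 : ∀ X → Unit X → ∀ n → Σ< (p ^ suc n) (λ i → E (X *ᶻ + i *ᶻ + q′)) ≈ 0#
  longLinearSum-unit≈0 X X-unit n = begin
    Σ< (p * p ^ n) (λ i → E (X *ᶻ + i *ᶻ + q′))                    ≈⟨ Σ<-* p (p ^ n) _ ⟩
    Σ< (p ^ n) (λ v → Σ< p (λ u → E (X *ᶻ + (u + p * v) *ᶻ + q′))) ≈⟨ Σ<-cong (p ^ n) (λ v → Σ<-cong p (λ u →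
                                                                         E-cong-mod (X *ᶻ + u *ᶻ + q′) (X *ᶻ + v) (shift u v))) ⟩
    Σ< (p ^ n) (λ v → linearSum X)                                  ≈⟨ Σ<-zero (p ^ n) (λ _ _ → linearSum-unit≈0 X X-unit) ⟩
    0#                                                              ∎
    where
    open ≈
    lemma : ∀ X u P v Q′ → X *ᶻ (u +ᶻ P *ᶻ v) *ᶻ Q′ ≡ X *ᶻ u *ᶻ Q′ +ᶻ (X *ᶻ v) *ᶻ (P *ᶻ Q′)
    lemma X u P v Q′ = solve (X ∷ u ∷ P ∷ v ∷ Q′ ∷ [])
    shift : ∀ u v → X *ᶻ + (u + p * v) *ᶻ + q′ ≡ X *ᶻ + u *ᶻ + q′ +ᶻ (X *ᶻ + v) *ᶻ + q
    shift u v = P.trans (P.cong (λ t → X *ᶻ t *ᶻ + q′) (pos-+-* u p v))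
                  (P.trans (lemma X (+ u) (+ p) (+ v) (+ q′))
                    (P.cong (λ t → X *ᶻ + u *ᶻ + q′ +ᶻ (X *ᶻ + v) *ᶻ t) (P.sym (ℤP.pos-* p q′))))

  E-scaled-mod-p : ∀ e → k ≤ e → ∀ {y} y′ z → y ≡ y′ +ᶻ z *ᶻ + p → ∀ j →
                   E (y *ᶻ + (p ^ e) *ᶻ j *ᶻ j) ≈ E (y′ *ᶻ + (p ^ e) *ᶻ j *ᶻ j)
  E-scaled-mod-p e k≤e {y} y′ z y≡y′+zp j = E-cong-mod (y′ *ᶻ + (p ^ e) *ᶻ j *ᶻ j) (z *ᶻ j *ᶻ j *ᶻ + (p ^ (e ∸ k)))
    (scaled-square-shift y′ z (+ p) (+ (p ^ e)) j (+ (p ^ (e ∸ k))) (+ q) y≡y′+zp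
      (P.trans (P.sym (ℤP.pos-* (p ^ e) p)) (P.trans (P.cong +_ pᵉ*p≡pᵉ⁻ᵏ*q) (ℤP.pos-* (p ^ (e ∸ k)) q))))
    where
    open P.≡-Reasoning
    pᵉ*p≡pᵉ⁻ᵏ*q : p ^ e * p ≡ p ^ (e ∸ k) * q
    pᵉ*p≡pᵉ⁻ᵏ*q = begin
      p ^ e * p             ≡⟨ ℕP.*-comm (p ^ e) p ⟩
      p ^ suc e             ≡⟨ P.cong (λ n → p ^ suc n) (ℕP.m∸n+n≡m k≤e) ⟨
      p ^ suc (e ∸ k + k)   ≡⟨ P.cong (p ^_) (ℕP.+-suc (e ∸ k) k) ⟨
      p ^ (e ∸ k + suc k)   ≡⟨ ℕP.^-distribˡ-+-* p (e ∸ k) (suc k) ⟩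
      p ^ (e ∸ k) * q       ∎

  gaussTerm : ℤ → ℕ → ℕ → Carrier
  gaussTerm y c j = E (y *ᶻ + (p ^ c) *ᶻ + j *ᶻ + j)

  -- For c + n = k + 1 this is the Gauss sum G(y; pⁿ); and 𝒢 y c (k + 1) is G(y pᶜ; p^(k+1)).
  𝒢 : ℤ → ℕ → ℕ → Carrier
  𝒢 y c n = Σ< (p ^ n) (gaussTerm y c)

  𝒢-periodic : ∀ y c n → c + n ≡ suc k → 𝒢 y c (suc k) ≈ Σ< (p ^ c) (λ _ → 𝒢 y c n)
  𝒢-periodic y c n c+n≡k+1 = begin
    Σ< q (gaussTerm y c)                                                 ≈⟨ Σ<-congˡ (gaussTerm y c) q≡pⁿ*pᶜ ⟩
    Σ< (p ^ n * p ^ c) (gaussTerm y c)                                   ≈⟨ Σ<-* (p ^ n) (p ^ c) (gaussTerm y c) ⟩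
    Σ< (p ^ c) (λ l → Σ< (p ^ n) (λ j → gaussTerm y c (j + p ^ n * l))) ≈⟨ Σ<-cong (p ^ c) (λ l →
                                                                             Σ<-cong (p ^ n) (λ j → term-periodic j l)) ⟩
    Σ< (p ^ c) (λ _ → 𝒢 y c n)                                           ∎
    where
    open ≈
    q≡pⁿ*pᶜ : q ≡ p ^ n * p ^ c
    q≡pⁿ*pᶜ = P.trans (P.cong (p ^_) (P.trans (P.sym c+n≡k+1) (ℕP.+-comm c n))) (ℕP.^-distribˡ-+-* p n c)
    lemma : ∀ {Q} y C N j l → C *ᶻ N ≡ Q →
            y *ᶻ C *ᶻ (j +ᶻ N *ᶻ l) *ᶻ (j +ᶻ N *ᶻ l) ≡ y *ᶻ C *ᶻ j *ᶻ j +ᶻ (y *ᶻ (+ 2 *ᶻ j *ᶻ l +ᶻ N *ᶻ l *ᶻ l)) *ᶻ Q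
    lemma y C N j l P.refl = solve (y ∷ C ∷ N ∷ j ∷ l ∷ [])
    term-periodic : ∀ j l → gaussTerm y c (j + p ^ n * l) ≈ gaussTerm y c j
    term-periodic j l =
      E-cong-mod (y *ᶻ + (p ^ c) *ᶻ + j *ᶻ + j) (y *ᶻ (+ 2 *ᶻ + j *ᶻ + l +ᶻ + (p ^ n) *ᶻ + l *ᶻ + l))
        (P.trans (P.cong (λ t → y *ᶻ + (p ^ c) *ᶻ t *ᶻ t) (pos-+-* j (p ^ n) l))
          (lemma y (+ (p ^ c)) (+ (p ^ n)) (+ j) (+ l)
            (P.trans (P.sym (ℤP.pos-* (p ^ c) (p ^ n)))
              (P.cong +_ (P.trans (P.sym (ℕP.^-distribˡ-+-* p c n)) (P.cong (p ^_) c+n≡k+1))))))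

  gaussTerm-split : ∀ y c m → c + (2 + m) ≡ suc k → ∀ j l →
                    gaussTerm y c (j + p ^ suc m * l) ≈ gaussTerm y c j ⊗ E (+ 2 *ᶻ y *ᶻ + j *ᶻ + l *ᶻ + q′)
  gaussTerm-split y c m c+2+m≡k+1 j l = begin
    gaussTerm y c (j + N * l)                                       ≈⟨ E-cong-mod (gaussArg +ᶻ linearArg) (y *ᶻ + l *ᶻ + l *ᶻ + (p ^ m)) expand ⟩
    E (y *ᶻ + (p ^ c) *ᶻ + j *ᶻ + j +ᶻ + 2 *ᶻ y *ᶻ + j *ᶻ + l *ᶻ + q′) ≈⟨ E-homo-+ gaussArg linearArg ⟩
    gaussTerm y c j ⊗ E (+ 2 *ᶻ y *ᶻ + j *ᶻ + l *ᶻ + q′)             ∎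
    where
    open ≈
    N : ℕ
    N = p ^ suc m
    gaussArg linearArg : ℤ
    gaussArg  = y *ᶻ + (p ^ c) *ᶻ + j *ᶻ + j
    linearArg = + 2 *ᶻ y *ᶻ + j *ᶻ + l *ᶻ + q′
    pᶜ*N≡q′ : p ^ c * N ≡ q′
    pᶜ*N≡q′ = P.trans (P.sym (ℕP.^-distribˡ-+-* p c (suc m)))
                (P.cong (p ^_) (ℕP.suc-injective (P.trans (P.sym (ℕP.+-suc c (suc m))) c+2+m≡k+1)))
    q′*N≡q*pᵐ : q′ * N ≡ q * p ^ m
    q′*N≡q*pᵐ = P.trans (P.sym (ℕP.^-distribˡ-+-* p k (suc m)))
                  (P.trans (P.cong (p ^_) (ℕP.+-suc k m)) (ℕP.^-distribˡ-+-* p (suc k) m))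
    expand : y *ᶻ + (p ^ c) *ᶻ + (j + N * l) *ᶻ + (j + N * l)
           ≡ (y *ᶻ + (p ^ c) *ᶻ + j *ᶻ + j +ᶻ + 2 *ᶻ y *ᶻ + j *ᶻ + l *ᶻ + q′) +ᶻ (y *ᶻ + l *ᶻ + l *ᶻ + (p ^ m)) *ᶻ + q
    expand = P.trans (P.cong (λ t → y *ᶻ + (p ^ c) *ᶻ t *ᶻ t) (pos-+-* j N l))
               (square-expand y (+ (p ^ c)) (+ N) (+ j) (+ l) (+ q) (+ (p ^ m))
                 (P.trans (P.sym (ℤP.pos-* (p ^ c) N)) (P.cong +_ pᶜ*N≡q′))
                 (P.trans (P.sym (ℤP.pos-* q′ N)) (P.trans (P.cong +_ q′*N≡q*pᵐ) (ℤP.pos-* q (p ^ m)))))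

  𝒢-unfold : ∀ y c m → c + (2 + m) ≡ suc k →
             𝒢 y c (2 + m) ≈ Σ< (p ^ suc m) (λ j → gaussTerm y c j ⊗ linearSum (+ 2 *ᶻ y *ᶻ + j))
  𝒢-unfold y c m c+2+m≡k+1 = begin
    Σ< (p * N) (gaussTerm y c)                                       ≈⟨ Σ<-congˡ (gaussTerm y c) (ℕP.*-comm p N) ⟩
    Σ< (N * p) (gaussTerm y c)                                       ≈⟨ Σ<-* N p (gaussTerm y c) ⟩
    Σ< p (λ l → Σ< N (λ j → gaussTerm y c (j + N * l)))              ≈⟨ Σ<-cong p (λ l → Σ<-cong N (λ j →
                                                                          gaussTerm-split y c m c+2+m≡k+1 j l)) ⟩
    Σ< p (λ l → Σ< N (λ j → gaussTerm y c j ⊗ χ j l))                ≈⟨ Σ<-swap p N (λ l j → gaussTerm y c j ⊗ χ j l) ⟩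
    Σ< N (λ j → Σ< p (λ l → gaussTerm y c j ⊗ χ j l))                ≈⟨ Σ<-cong N (λ j → Σ<-distribˡ-⊗ p (χ j) (gaussTerm y c j)) ⟩
    Σ< N (λ j → gaussTerm y c j ⊗ linearSum (+ 2 *ᶻ y *ᶻ + j))       ∎
    where
    open ≈
    N : ℕ
    N = p ^ suc m
    χ : ℕ → ℕ → Carrier
    χ j l = E (+ 2 *ᶻ y *ᶻ + j *ᶻ + l *ᶻ + q′)

  𝒢-recurrence : p ≢ 2 → ∀ y → Unit y → ∀ c m → c + (2 + m) ≡ suc k → 𝒢 y c (2 + m) ≈ 𝒢 y (2 + c) m ⊗ p·1
  𝒢-recurrence p≢2 y y-unit c m c+2+m≡k+1 = begin
    𝒢 y c (2 + m)                                  ≈⟨ 𝒢-unfold y c m c+2+m≡k+1 ⟩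
    Σ< (p * p ^ m) S                               ≈⟨ Σ<-* p (p ^ m) S ⟩
    Σ< (p ^ m) (λ v → Σ< p (λ u → S (u + p * v)))  ≈⟨ Σ<-cong (p ^ m) (λ v →
                                                        Σ<-head p (λ u → S (u + p * v)) (ℕP.<-trans ℕP.0<1+n 1<p) (S≈0 v)) ⟩
    Σ< (p ^ m) (λ v → S (p * v))                   ≈⟨ Σ<-cong (p ^ m) S[pv]≈ ⟩
    Σ< (p ^ m) (λ v → gaussTerm y (2 + c) v ⊗ p·1) ≈⟨ Σ<-distribʳ-⊗ (p ^ m) (gaussTerm y (2 + c)) p·1 ⟩
    𝒢 y (2 + c) m ⊗ p·1                            ∎
    where
    open ≈
    S : ℕ → Carrier
    S j = gaussTerm y c j ⊗ linearSum (+ 2 *ᶻ y *ᶻ + j)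
    2yt-unit : ∀ u v → 0 < u → u < p → Unit (+ 2 *ᶻ y *ᶻ + (u + p * v))
    2yt-unit u@(suc _) v _ u<p = unit-* (+ 2 *ᶻ y) (+ (u + p * v)) (unit-* (+ 2) y (unit-2 p≢2) y-unit) p∤u+pv
      where
      p∤u+pv : ¬ (p ℕ∣.∣ u + p * v)
      p∤u+pv p∣u+pv =
        ℕP.<⇒≱ u<p (ℕ∣.∣⇒≤ (ℕ∣.∣m+n∣m⇒∣n (P.subst (p ℕ∣.∣_) (ℕP.+-comm u (p * v)) p∣u+pv) (ℕ∣.m∣m*n v)))
    rescale : ∀ v → y *ᶻ + (p ^ c) *ᶻ + (p * v) *ᶻ + (p * v) ≡ y *ᶻ + (p ^ (2 + c)) *ᶻ + v *ᶻ + v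
    rescale v = P.trans (P.cong (λ t → y *ᶻ + (p ^ c) *ᶻ t *ᶻ t) (ℤP.pos-* p v))
                  (P.trans (lemma y (+ p) (+ (p ^ c)) (+ v))
                    (P.cong (λ t → y *ᶻ t *ᶻ + v *ᶻ + v)
                      (P.sym (P.trans (ℤP.pos-* p (p * p ^ c)) (P.cong (+ p *ᶻ_) (ℤP.pos-* p (p ^ c)))))))
      where
      lemma : ∀ y P C v → y *ᶻ C *ᶻ (P *ᶻ v) *ᶻ (P *ᶻ v) ≡ y *ᶻ (P *ᶻ (P *ᶻ C)) *ᶻ v *ᶻ v
      lemma y P C v = solve (y ∷ P ∷ C ∷ v ∷ [])
    double : ∀ v → + 2 *ᶻ y *ᶻ + (p * v) ≡ (+ 2 *ᶻ y *ᶻ + v) *ᶻ + p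
    double v = P.trans (P.cong (+ 2 *ᶻ y *ᶻ_) (ℤP.pos-* p v)) (lemma y (+ p) (+ v))
      where
      lemma : ∀ y P v → + 2 *ᶻ y *ᶻ (P *ᶻ v) ≡ (+ 2 *ᶻ y *ᶻ v) *ᶻ P
      lemma y P v = solve (y ∷ P ∷ v ∷ [])
    S≈0 : ∀ v u → 0 < u → u < p → S (u + p * v) ≈ 0#
    S≈0 v u 0<u u<p =
      trans (*-congˡ (linearSum-unit≈0 (+ 2 *ᶻ y *ᶻ + (u + p * v)) (2yt-unit u v 0<u u<p))) (zeroʳ _)
    S[pv]≈ : ∀ v → S (p * v) ≈ gaussTerm y (2 + c) v ⊗ p·1
    S[pv]≈ v = *-cong (reflexive (P.cong E (rescale v)))
                 (trans (reflexive (P.cong linearSum (double v))) (linearSum-multiple (+ 2 *ᶻ y *ᶻ + v)))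

  𝒢-mod-p : p ≢ 2 → ∀ {y} y′ z → y ≡ y′ +ᶻ z *ᶻ + p → Unit y → Unit y′ →
            ∀ c n → c + n ≡ suc k → 𝒢 y c n ≈ 𝒢 y′ c n
  𝒢-mod-p p≢2 y′ z y≡y′+zp y-unit y′-unit c zero c+0≡k+1 =
    Σ<-cong 1 (λ j → E-scaled-mod-p c k≤c y′ z y≡y′+zp (+ j))
    where
    k≤c : k ≤ c
    k≤c = ℕP.≤-trans (ℕP.n≤1+n k) (ℕP.≤-reflexive (P.trans (P.sym c+0≡k+1) (ℕP.+-identityʳ c)))
  𝒢-mod-p p≢2 y′ z y≡y′+zp y-unit y′-unit c (suc zero) c+1≡k+1 =
    Σ<-cong (p ^ 1) (λ j → E-scaled-mod-p c k≤c y′ z y≡y′+zp (+ j))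
    where
    k≤c : k ≤ c
    k≤c = ℕP.≤-reflexive (ℕP.suc-injective (P.trans (P.sym c+1≡k+1) (ℕP.+-comm c 1)))
  𝒢-mod-p p≢2 {y} y′ z y≡y′+zp y-unit y′-unit c (suc (suc m)) c+2+m≡k+1 = begin
    𝒢 y c (2 + m)          ≈⟨ 𝒢-recurrence p≢2 y y-unit c m c+2+m≡k+1 ⟩
    𝒢 y (2 + c) m ⊗ p·1    ≈⟨ *-congʳ (𝒢-mod-p p≢2 y′ z y≡y′+zp y-unit y′-unit (2 + c) m 2+c+m≡k+1) ⟩
    𝒢 y′ (2 + c) m ⊗ p·1   ≈⟨ 𝒢-recurrence p≢2 y′ y′-unit c m c+2+m≡k+1 ⟨
    𝒢 y′ c (2 + m)         ∎
    where
    open ≈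
    2+c+m≡k+1 : 2 + c + m ≡ suc k
    2+c+m≡k+1 = P.trans (P.sym (P.trans (ℕP.+-suc c (suc m)) (P.cong suc (ℕP.+-suc c m)))) c+2+m≡k+1

  G-mod-p : p ≢ 2 → ∀ e {A} A′ z → A ≡ A′ +ᶻ z *ᶻ + p → Unit A → Unit A′ →
            G q ζ (A *ᶻ + (p ^ e)) ≈ G q ζ (A′ *ᶻ + (p ^ e))
  G-mod-p p≢2 e {A} A′ z A≡A′+zp A-unit A′-unit with ℕP.≤-total e (suc k)
  ... | inj₁ e≤k+1 = begin
    𝒢 A e (suc k)               ≈⟨ 𝒢-periodic A e n e+n≡k+1 ⟩
    Σ< (p ^ e) (λ _ → 𝒢 A e n)  ≈⟨ Σ<-cong (p ^ e) (λ _ → 𝒢-mod-p p≢2 A′ z A≡A′+zp A-unit A′-unit e n e+n≡k+1) ⟩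
    Σ< (p ^ e) (λ _ → 𝒢 A′ e n) ≈⟨ 𝒢-periodic A′ e n e+n≡k+1 ⟨
    𝒢 A′ e (suc k)              ∎
    where
    open ≈
    n : ℕ
    n = suc k ∸ e
    e+n≡k+1 : e + n ≡ suc k
    e+n≡k+1 = ℕP.m+[n∸m]≡n e≤k+1
  ... | inj₂ k+1≤e = Σ<-cong q (λ j → E-scaled-mod-p e (ℕP.<⇒≤ k+1≤e) A′ z A≡A′+zp (+ j))

module Vanishing {c ℓ} (R : CommutativeRing c ℓ) (p : ℕ) (p-prime : Prime p) (p≢2 : p ≢ 2) (k : ℕ)
                 (ζ : CommutativeRing.Carrier R) (ζ-root : Cyclo.CyclotomicRoot R p (suc k) ζ)
                 (a b₀ : ℤ) (b₁ : ℕ) (c₀ : ℤ) (c₁ : ℕ) (m₀ : ℤ) (m₁ τ d : ℕ)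
                 (τ+m₁+2+d≡k+1 : τ + m₁ + 2 + d ≡ suc k)
                 (a-unit : PrimeModulus.Unit p p-prime a) (b₀-unit : PrimeModulus.Unit p p-prime b₀)
                 (c₀-unit : PrimeModulus.Unit p p-prime c₀) (m₀-unit : PrimeModulus.Unit p p-prime m₀) where
  open CommutativeRing R renaming (_+_ to _⊕_; _*_ to _⊗_)
  open Cyclo R using (Σ<; G; s)
  open FiniteSums R
  open PrimeModulus p p-prime
  open PrimePowerRoot R p p-prime k ζ ζ-root
  open CommSemigroupProperties *-commutativeSemigroup using (xy∙z≈xz∙y)
  private module ≈ = Relation.Binary.Reasoning.Setoid setoid

  T : ℤ → Carrier
  T t = E (-ᶻ m₀ *ᶻ t *ᶻ + (p ^ (m₁ + τ)))
      ⊗ G q ζ (a *ᶻ t *ᶻ + (p ^ τ))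
      ⊗ G q ζ (b₀ *ᶻ t *ᶻ + (p ^ (b₁ + τ)))
      ⊗ G q ζ (c₀ *ᶻ t *ᶻ + (p ^ (c₁ + τ)))

  N : ℕ
  N = p ^ (suc k ∸ τ)

  summand : ℕ → Carrier
  summand t = if does (coprime? t N) then T (+ t) else 0#

  D P : ℕ
  D = p ^ suc d
  P = p ^ suc m₁

  N≡D*P : N ≡ D * P
  N≡D*P = P.trans (P.cong (p ^_) k+1∸τ≡[d+1]+[m₁+1]) (ℕP.^-distribˡ-+-* p (suc d) (suc m₁))
    where
    regroup : τ + m₁ + 2 + d ≡ τ + (suc d + suc m₁)
    regroup = ℕSolver.solve (τ ∷ m₁ ∷ d ∷ [])
    k+1∸τ≡[d+1]+[m₁+1] : suc k ∸ τ ≡ suc d + suc m₁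
    k+1∸τ≡[d+1]+[m₁+1] =
      P.trans (P.cong (_∸ τ) (P.trans (P.sym τ+m₁+2+d≡k+1) regroup)) (ℕP.m+n∸m≡n τ (suc d + suc m₁))

  D*pᵐ¹⁺ᵗ≡q′ : D * p ^ (m₁ + τ) ≡ q′
  D*pᵐ¹⁺ᵗ≡q′ = P.trans (P.sym (ℕP.^-distribˡ-+-* p (suc d) (m₁ + τ)))
                 (P.cong (p ^_) (ℕP.suc-injective (P.trans regroup τ+m₁+2+d≡k+1)))
    where
    regroup : suc (suc d + (m₁ + τ)) ≡ τ + m₁ + 2 + d
    regroup = ℕSolver.solve (τ ∷ m₁ ∷ d ∷ [])

  p∤r+D*i : ∀ {r} i → ¬ (p ℕ∣.∣ r) → ¬ (p ℕ∣.∣ r + D * i)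
  p∤r+D*i {r} i p∤r p∣r+D*i =
    p∤r (ℕ∣.∣m+n∣m⇒∣n (P.subst (p ℕ∣.∣_) (ℕP.+-comm r (D * i)) p∣r+D*i) (ℕ∣.∣m⇒∣m*n i (ℕ∣.m∣m*n (p ^ d))))

  T-shift : ∀ r i → ¬ (p ℕ∣.∣ r) →
            T (+ (r + D * i)) ≈ T (+ r) ⊗ E (-ᶻ m₀ *ᶻ + i *ᶻ + q′)
  T-shift r i p∤r = begin
    T t                        ≈⟨ *-cong (*-cong (*-cong E-split (G-shift a τ a-unit))
                                    (G-shift b₀ (b₁ + τ) b₀-unit)) (G-shift c₀ (c₁ + τ) c₀-unit) ⟩
    (Eʳ ⊗ Eⁱ) ⊗ Gᵃ ⊗ Gᵇ ⊗ Gᶜ    ≈⟨ move-last Eʳ Eⁱ Gᵃ Gᵇ Gᶜ ⟩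
    T (+ r) ⊗ Eⁱ               ∎
    where
    open ≈
    t : ℤ
    t = + (r + D * i)
    Eʳ Eⁱ Gᵃ Gᵇ Gᶜ : Carrier
    Eʳ = E (-ᶻ m₀ *ᶻ + r *ᶻ + (p ^ (m₁ + τ)))
    Eⁱ = E (-ᶻ m₀ *ᶻ + i *ᶻ + q′)
    Gᵃ = G q ζ (a *ᶻ + r *ᶻ + (p ^ τ))
    Gᵇ = G q ζ (b₀ *ᶻ + r *ᶻ + (p ^ (b₁ + τ)))
    Gᶜ = G q ζ (c₀ *ᶻ + r *ᶻ + (p ^ (c₁ + τ)))
    move-last : ∀ w u x y z → (w ⊗ u) ⊗ x ⊗ y ⊗ z ≈ w ⊗ x ⊗ y ⊗ z ⊗ u
    move-last w u x y z = trans (*-congʳ (*-congʳ (xy∙z≈xz∙y w u x)))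
                            (trans (*-congʳ (xy∙z≈xz∙y (w ⊗ x) u y)) (xy∙z≈xz∙y (w ⊗ x ⊗ y) u z))
    E-split : E (-ᶻ m₀ *ᶻ t *ᶻ + (p ^ (m₁ + τ))) ≈ Eʳ ⊗ Eⁱ
    E-split = trans (reflexive (P.cong E (P.trans (P.cong (λ x → -ᶻ m₀ *ᶻ x *ᶻ + (p ^ (m₁ + τ))) (pos-+-* r D i))
                (P.trans (lemma (-ᶻ m₀) (+ r) (+ D) (+ i) (+ (p ^ (m₁ + τ))))
                  (P.cong (λ x → -ᶻ m₀ *ᶻ + r *ᶻ + (p ^ (m₁ + τ)) +ᶻ -ᶻ m₀ *ᶻ + i *ᶻ x)
                    (P.trans (P.sym (ℤP.pos-* D (p ^ (m₁ + τ)))) (P.cong +_ D*pᵐ¹⁺ᵗ≡q′)))))))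
              (E-homo-+ (-ᶻ m₀ *ᶻ + r *ᶻ + (p ^ (m₁ + τ))) (-ᶻ m₀ *ᶻ + i *ᶻ + q′))
      where
      lemma : ∀ x r D i Q → x *ᶻ (r +ᶻ D *ᶻ i) *ᶻ Q ≡ x *ᶻ r *ᶻ Q +ᶻ x *ᶻ i *ᶻ (D *ᶻ Q)
      lemma x r D i Q = solve (x ∷ r ∷ D ∷ i ∷ Q ∷ [])
    t≡r+[pᵈi]p : t ≡ + r +ᶻ + (p ^ d * i) *ᶻ + p
    t≡r+[pᵈi]p = P.trans (P.cong (λ n → + (r + n)) (nat-lemma p (p ^ d) i)) (pos-+-* r (p ^ d * i) p)
      where
      nat-lemma : ∀ p pᵈ i → p * pᵈ * i ≡ pᵈ * i * p
      nat-lemma p pᵈ i = ℕSolver.solve (p ∷ pᵈ ∷ i ∷ [])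
    G-shift : ∀ X e → Unit X → G q ζ (X *ᶻ t *ᶻ + (p ^ e)) ≈ G q ζ (X *ᶻ + r *ᶻ + (p ^ e))
    G-shift X e X-unit = G-mod-p p≢2 e (X *ᶻ + r) (X *ᶻ + (p ^ d * i))
      (P.trans (P.cong (X *ᶻ_) t≡r+[pᵈi]p) (lemma X (+ r) (+ (p ^ d * i)) (+ p)))
      (unit-* X t X-unit (p∤r+D*i i p∤r)) (unit-* X (+ r) X-unit p∤r)
      where
      lemma : ∀ X r z P → X *ᶻ (r +ᶻ z *ᶻ P) ≡ X *ᶻ r +ᶻ (X *ᶻ z) *ᶻ P
      lemma X r z P = solve (X ∷ r ∷ z ∷ P ∷ [])

  column≈0 : ∀ r → Σ< P (λ i → summand (r + D * i)) ≈ 0#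
  column≈0 r with p ∣? r
  ... | yes p∣r = Σ<-zero P (λ i _ → reflexive (P.cong (λ b → if b then T (+ (r + D * i)) else 0#)
                                                  (dec-false (coprime? (r + D * i) N) (¬coprime i))))
    where
    ¬coprime : ∀ i → ¬ Coprime (r + D * i) N
    ¬coprime i coprime = ℕP.<⇒≢ 1<p (P.sym (coprime (p∣r+D*i , p∣N)))
      where
      p∣r+D*i : p ℕ∣.∣ r + D * i
      p∣r+D*i = ℕ∣.∣m∣n⇒∣m+n p∣r (ℕ∣.∣m⇒∣m*n i (ℕ∣.m∣m*n (p ^ d)))
      p∣N : p ℕ∣.∣ N
      p∣N = P.subst (p ℕ∣.∣_) (P.sym N≡D*P) (ℕ∣.∣m⇒∣m*n P (ℕ∣.m∣m*n (p ^ d)))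
  ... | no p∤r = begin
    Σ< P (λ i → summand (r + D * i))                 ≈⟨ Σ<-cong P (λ i → trans (summand≈T i) (T-shift r i p∤r)) ⟩
    Σ< P (λ i → T (+ r) ⊗ E (-ᶻ m₀ *ᶻ + i *ᶻ + q′))  ≈⟨ Σ<-distribˡ-⊗ P (λ i → E (-ᶻ m₀ *ᶻ + i *ᶻ + q′)) (T (+ r)) ⟩
    T (+ r) ⊗ Σ< P (λ i → E (-ᶻ m₀ *ᶻ + i *ᶻ + q′))  ≈⟨ *-congˡ (longLinearSum-unit≈0 (-ᶻ m₀) (unit-neg m₀ m₀-unit) m₁) ⟩
    T (+ r) ⊗ 0#                                     ≈⟨ zeroʳ (T (+ r)) ⟩
    0#                                               ∎
    where
    open ≈
    summand≈T : ∀ i → summand (r + D * i) ≈ T (+ (r + D * i))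
    summand≈T i = reflexive (P.cong (λ b → if b then T (+ (r + D * i)) else 0#)
                          (dec-true (coprime? (r + D * i) N) (coprime-^ (p∤r+D*i i p∤r) (suc k ∸ τ))))

  s≈0 : s p {{p≢0}} ζ (suc k) τ a b₀ b₁ c₀ c₁ m₀ m₁ ≈ 0#
  s≈0 = begin
    Σ< N summand                                      ≈⟨ Σ<-congˡ summand N≡D*P ⟩
    Σ< (D * P) summand                                ≈⟨ Σ<-* D P summand ⟩
    Σ< P (λ i → Σ< D (λ r → summand (r + D * i)))     ≈⟨ Σ<-swap P D (λ i r → summand (r + D * i)) ⟩
    Σ< D (λ r → Σ< P (λ i → summand (r + D * i)))     ≈⟨ Σ<-zero D (λ r _ → column≈0 r) ⟩
    0#                                                ∎
    where open ≈

lemma4p1 : ∀ {c ℓ : Level} (R : CommutativeRing c ℓ) (p : ℕ) (pr : Prime p) → p ≢ 2 →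
    (a : ℤ) → ¬ ((+ p) ∣ a) →
    (b₀ : ℤ) (b₁ : ℕ) (c₀ : ℤ) (c₁ : ℕ) → b₁ ≤ c₁ →
    Coprime ∣ b₀ ∣ p → Coprime ∣ c₀ ∣ p →
    (m₀ : ℤ) (m₁ : ℕ) → m₀ ≢ ℤ.0ℤ → Coprime ∣ m₀ ∣ p →
    (k : ℕ) → m₁ < k →
    (ζ : CommutativeRing.Carrier R) → Cyclo.CyclotomicRoot R p k ζ →
    (τ : ℕ) → τ + m₁ + 2 ≤ k →
    CommutativeRing._≈_ R
      (Cyclo.s R p {{prime⇒nonZero pr}} ζ k τ a b₀ b₁ c₀ c₁ m₀ m₁)
      (CommutativeRing.0# R)
lemma4p1 R p p-prime p≢2 a p∤a b₀ b₁ c₀ c₁ _ b₀⊥p c₀⊥p m₀ m₁ _ m₀⊥p zero () ζ ζ-root τ τ+m₁+2≤k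
lemma4p1 R p p-prime p≢2 a p∤a b₀ b₁ c₀ c₁ _ b₀⊥p c₀⊥p m₀ m₁ _ m₀⊥p (suc k) _ ζ ζ-root τ τ+m₁+2≤k+1
  with ℕP.m≤n⇒∃[o]m+o≡n τ+m₁+2≤k+1
... | d , τ+m₁+2+d≡k+1 =
  Vanishing.s≈0 R p p-prime p≢2 k ζ ζ-root a b₀ b₁ c₀ c₁ m₀ m₁ τ d τ+m₁+2+d≡k+1
    p∤a (coprime⇒unit b₀ b₀⊥p) (coprime⇒unit c₀ c₀⊥p) (coprime⇒unit m₀ m₀⊥p)
  where open PrimeModulus p p-prime using (coprime⇒unit)
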